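{- For every $n\ge 1$ and positive integers $q_1,\dots,q_n$, with $Q=\{q_1,\dots,q_n\}$, $$\binom{1,n}{1,Q}=q_1q_2\cdots q_n\cdot\frac{\sum_{i=1}^n q_i-n+2}{2}.$$ In particular $\binom{1,2}{1,Q}=\frac{q_1q_2(q_1+q_2)}{2}$ when $n=2$.
   Context: For a finite list $Q=\{q_1,\dots,q_n\}$ of positive integers (repetitions allowed) and a nonnegative integer $m$, let $X$ be a set which is the disjoint union of "main blocks" $X_1,\dots,X_n$ with $|X_i|=q_i$ and an "additional block" $Y$ with $|Y|=m$. An $(n+k)$-inset of $X$ is an $(n+k)$-element subset of $X$ that intersects every main block. The number of $(n+k)$-insets of $X$ is denoted $\binom{m,n}{k,Q}$. -}

module Defs where

open import Data.Nat using (ℕ; zero; suc; _+_; _*_; _≡ᵇ_)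
open import Data.Bool using (Bool; true; false; _∧_; _∨_; if_then_else_)
open import Data.Maybe using (Maybe; just; nothing)
open import Data.Fin using (Fin)
open import Data.Fin.Properties using () renaming (_≟_ to _≟ᶠ_)
open import Data.List using (List; []; _∷_; _++_; replicate; concat; map; length; filter; allFin; zip; foldr)
open import Data.Nat.ListAction using (product)
open import Data.Vec using (Vec; toList)
open import Data.Vec.Functional as VF using ()
open import Relation.Nullary.Decidable using (⌊_⌋)

-- An element labelled  just i
-- lies in the main block X_i (so X_i has q_i elements); an element labelled
-- nothing lies in the additional block Y (m elements).
groundLabels : ∀ {n} → Vec ℕ n → ℕ → List (Maybe (Fin n))
groundLabels {n} q m =
  concat (map (λ i → replicate (Data.Vec.lookup q i) (just i)) (allFin n))
  ++ replicate m nothing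

-- All subsets of a list, each subset given as the list of its chosen elements
-- (distinct positions of the list are distinct elements of X).
subsets : {A : Set} → List A → List (List A)
subsets [] = [] ∷ []
subsets (x ∷ xs) = let r = subsets xs in map (x ∷_) r ++ r

meets : ∀ {n} → Fin n → List (Maybe (Fin n)) → Bool
meets i [] = false
meets i (just j ∷ s) = ⌊ i ≟ᶠ j ⌋ ∨ meets i s
meets i (nothing ∷ s) = meets i s

isInset : ∀ {n} → ℕ → List (Maybe (Fin n)) → Bool
isInset {n} k s =
  (length s ≡ᵇ (n + k)) ∧ foldr _∧_ true (map (λ i → meets i s) (allFin n))

-- The number of (n+k)-insets of X, written  binom(m,n ; k,Q)  in the paper.
insetCount : ∀ {n} → (m : ℕ) → (k : ℕ) → Vec ℕ n → ℕ
insetCount m k q = length (filter (λ s → Data.Bool._≟_ (isInset k s) true) (subsets (groundLabels q m)))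

prodV : ∀ {n} → Vec ℕ n → ℕ
prodV q = product (toList q)

-- Splitting off the first main block, a t-element inset is an l-subset of X₁ (l ≥ 1)
-- together with a (t − l)-element inset of the remaining blocks, so the counts obey a
-- binomial recursion in q₁.  Hence no inset has fewer than n elements, those with n
-- pick one element per block (∏ qᵢ of them), and those with n + 1 pick two elements of
-- one block or an extra element of Y; induction over the blocks gives
-- 2·binom(m,n;1,Q) + n ∏ qᵢ = ∏ qᵢ (Σ qᵢ + 2m), a form free of truncated subtraction.
module Submission where

open import Defs
open import Data.Nat using (ℕ; suc; _+_; _*_; _∸_; _≥_)
open import Data.Vec using (Vec; sum)
open import Data.Vec.Relation.Unary.All using (All)
open import Relation.Binary.PropositionalEquality using (_≡_)

open import Data.Nat using (zero; _≡ᵇ_; _≤_; _<_; z≤n; s≤s; _<?_)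
open import Data.Nat.Properties
open import Data.Nat.ListAction using () renaming (sum to sumᴸ)
open import Data.Nat.ListAction.Properties using () renaming (sum-++ to sumᴸ-++)
open import Data.Nat.Tactic.RingSolver using (solve-∀)
open import Data.Bool using (Bool; true; false; _∧_; _∨_; if_then_else_)
import Data.Bool as Bool
open import Data.Bool.Properties using (∧-zeroʳ; ∧-identityʳ)
open import Data.Maybe using (Maybe; just; nothing)
import Data.Maybe as Maybe
open import Data.Fin using (Fin)
import Data.Fin as Fin
open import Data.Fin.Properties using () renaming (_≟_ to _≟ᶠ_)
open import Data.List
  using (List; []; _∷_; _++_; map; concat; concatMap; replicate; tabulate; allFin; foldr; length; filter)
open import Data.List.Properties
open import Data.Vec using ([]; _∷_; lookup)
open import Data.Vec.Relation.Unary.All using ([]; _∷_)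
open import Data.Product using (_,_)
open import Function using (_∘_)
open import Relation.Binary.PropositionalEquality using (refl; sym; trans; cong; cong₂; module ≡-Reasoning)
open import Relation.Nullary using (yes; no)
open import Relation.Nullary.Decidable using (⌊_⌋)

private
  variable
    A B : Set
    n : ℕ

indicator : (A → Bool) → A → ℕ
indicator p x = if p x then 1 else 0

length-filter-true : (p : A → Bool) (xs : List A) →
  length (filter (λ x → p x Bool.≟ true) xs) ≡ sumᴸ (map (indicator p) xs)
length-filter-true p [] = refl
length-filter-true p (x ∷ xs) with p x
... | true = cong suc (length-filter-true p xs)
... | false = length-filter-true p xs

sumᴸ-concatMap : (f : A → List ℕ) (xs : List A) →
  sumᴸ (concatMap f xs) ≡ sumᴸ (map (sumᴸ ∘ f) xs)
sumᴸ-concatMap f [] = refl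
sumᴸ-concatMap f (x ∷ xs) =
  trans (sumᴸ-++ (f x) (concatMap f xs)) (cong (sumᴸ (f x) +_) (sumᴸ-concatMap f xs))

sumᴸ-map-zero : (F : A → ℕ) → (∀ x → F x ≡ 0) → (xs : List A) → sumᴸ (map F xs) ≡ 0
sumᴸ-map-zero F F≡0 [] = refl
sumᴸ-map-zero F F≡0 (x ∷ xs) = cong₂ _+_ (F≡0 x) (sumᴸ-map-zero F F≡0 xs)

subsets-map : (f : A → B) (xs : List A) → subsets (map f xs) ≡ map (map f) (subsets xs)
subsets-map f [] = refl
subsets-map f (x ∷ xs) = begin
    map (f x ∷_) (subsets (map f xs)) ++ subsets (map f xs)
  ≡⟨ cong (λ R → map (f x ∷_) R ++ R) (subsets-map f xs) ⟩
    map (f x ∷_) (map (map f) S) ++ map (map f) S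
  ≡⟨ cong (_++ map (map f) S) (trans (sym (map-∘ S)) (map-∘ S)) ⟩
    map (map f) (map (x ∷_) S) ++ map (map f) S
  ≡⟨ map-++ (map f) (map (x ∷_) S) S ⟨
    map (map f) (map (x ∷_) S ++ S)
  ∎
  where
  open ≡-Reasoning
  S = subsets xs

subsets-++ : (xs ys : List A) →
  subsets (xs ++ ys) ≡ concatMap (λ a → map (a ++_) (subsets ys)) (subsets xs)
subsets-++ [] ys = sym (trans (++-identityʳ _) (map-id (subsets ys)))
subsets-++ (x ∷ xs) ys = begin
    map (x ∷_) (subsets (xs ++ ys)) ++ subsets (xs ++ ys)
  ≡⟨ cong (λ R → map (x ∷_) R ++ R) (subsets-++ xs ys) ⟩
    map (x ∷_) (concatMap g S) ++ concatMap g S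
  ≡⟨ cong (_++ concatMap g S) (map-concatMap (x ∷_) g S) ⟩
    concatMap (map (x ∷_) ∘ g) S ++ concatMap g S
  ≡⟨ cong (_++ concatMap g S) (concatMap-cong (λ a → sym (map-∘ (subsets ys))) S) ⟩
    concatMap (g ∘ (x ∷_)) S ++ concatMap g S
  ≡⟨ cong (_++ concatMap g S) (concatMap-map g (x ∷_) S) ⟨
    concatMap g (map (x ∷_) S) ++ concatMap g S
  ≡⟨ concatMap-++ g (map (x ∷_) S) S ⟨
    concatMap g (map (x ∷_) S ++ S)
  ∎
  where
  open ≡-Reasoning
  S = subsets xs
  g = λ a → map (a ++_) (subsets ys)

-- binomialSum q h = Σₗ (q choose l) · h l, computed by Pascal's rule.
binomialSum : ℕ → (ℕ → ℕ) → ℕ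
binomialSum zero h = h 0
binomialSum (suc q) h = binomialSum q (h ∘ suc) + binomialSum q h

binomialSum-cong : ∀ q {h h′ : ℕ → ℕ} → (∀ l → h l ≡ h′ l) → binomialSum q h ≡ binomialSum q h′
binomialSum-cong zero h≡h′ = h≡h′ 0
binomialSum-cong (suc q) h≡h′ =
  cong₂ _+_ (binomialSum-cong q (h≡h′ ∘ suc)) (binomialSum-cong q h≡h′)

binomialSum-zero : ∀ q {h : ℕ → ℕ} → (∀ l → h l ≡ 0) → binomialSum q h ≡ 0
binomialSum-zero zero h≡0 = h≡0 0
binomialSum-zero (suc q) h≡0 = cong₂ _+_ (binomialSum-zero q (h≡0 ∘ suc)) (binomialSum-zero q h≡0)

choose₂ : ℕ → ℕ
choose₂ zero = 0
choose₂ (suc q) = q + choose₂ q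

2*choose₂+q≡q*q : ∀ q → 2 * choose₂ q + q ≡ q * q
2*choose₂+q≡q*q zero = refl
2*choose₂+q≡q*q (suc q) = begin
    2 * (q + choose₂ q) + suc q      ≡⟨ regroup q (choose₂ q) ⟩
    2 * choose₂ q + q + (2 * q + 1)  ≡⟨ cong (_+ (2 * q + 1)) (2*choose₂+q≡q*q q) ⟩
    q * q + (2 * q + 1)              ≡⟨ square q ⟩
    suc q * suc q                    ∎
  where
  open ≡-Reasoning
  regroup : ∀ q c → 2 * (q + c) + suc q ≡ 2 * c + q + (2 * q + 1)
  regroup = solve-∀
  square : ∀ q → q * q + (2 * q + 1) ≡ suc q * suc q
  square = solve-∀

binomialSum-quadratic : ∀ q (h : ℕ → ℕ) {a b c} → h 0 ≡ a → h 1 ≡ b → h 2 ≡ c →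
  (∀ l → h (3 + l) ≡ 0) → binomialSum q h ≡ a + q * b + choose₂ q * c
binomialSum-quadratic zero h h₀ h₁ h₂ h₃ = trans h₀ (sym (trans (+-identityʳ _) (+-identityʳ _)))
binomialSum-quadratic (suc q) h {a} {b} {c} h₀ h₁ h₂ h₃ = begin
    binomialSum q (h ∘ suc) + binomialSum q h
  ≡⟨ cong₂ _+_ (binomialSum-quadratic q (h ∘ suc) h₁ h₂ (h₃ 0) (h₃ ∘ suc))
               (binomialSum-quadratic q h h₀ h₁ h₂ h₃) ⟩
    b + q * c + choose₂ q * 0 + (a + q * b + choose₂ q * c)
  ≡⟨ regroup a b c q (choose₂ q) ⟩
    a + suc q * b + (q + choose₂ q) * c
  ∎
  where
  open ≡-Reasoning
  regroup : ∀ a b c q k → b + q * c + k * 0 + (a + q * b + k * c) ≡ a + suc q * b + (q + k) * c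
  regroup = solve-∀

sumᴸ-subsets-replicate : (F : List A → ℕ) (q : ℕ) (x : A) →
  sumᴸ (map F (subsets (replicate q x))) ≡ binomialSum q (λ l → F (replicate l x))
sumᴸ-subsets-replicate F zero x = +-identityʳ _
sumᴸ-subsets-replicate F (suc q) x = begin
    sumᴸ (map F (map (x ∷_) R ++ R))
  ≡⟨ cong sumᴸ (map-++ F (map (x ∷_) R) R) ⟩
    sumᴸ (map F (map (x ∷_) R) ++ map F R)
  ≡⟨ sumᴸ-++ (map F (map (x ∷_) R)) (map F R) ⟩
    sumᴸ (map F (map (x ∷_) R)) + sumᴸ (map F R)
  ≡⟨ cong (λ L → sumᴸ L + sumᴸ (map F R)) (map-∘ R) ⟨
    sumᴸ (map (F ∘ (x ∷_)) R) + sumᴸ (map F R)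
  ≡⟨ cong₂ _+_ (sumᴸ-subsets-replicate (F ∘ (x ∷_)) q x) (sumᴸ-subsets-replicate F q x) ⟩
    binomialSum (suc q) (λ l → F (replicate l x))
  ∎
  where
  open ≡-Reasoning
  R = subsets (replicate q x)

l+m≡ᵇl+n : ∀ l m n → (l + m ≡ᵇ l + n) ≡ (m ≡ᵇ n)
l+m≡ᵇl+n zero m n = refl
l+m≡ᵇl+n (suc l) m n = l+m≡ᵇl+n l m n

m+n≡ᵇo≡false : ∀ m n o → o < m → (m + n ≡ᵇ o) ≡ false
m+n≡ᵇo≡false (suc m) n zero _ = refl
m+n≡ᵇo≡false (suc m) n (suc o) (s≤s o<m) = m+n≡ᵇo≡false m n o o<m

meetsAll : List (Maybe (Fin n)) → Bool
meetsAll {n} s = foldr _∧_ true (map (λ i → meets i s) (allFin n))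

isInsetOfSize : ℕ → List (Maybe (Fin n)) → Bool
isInsetOfSize t s = (length s ≡ᵇ t) ∧ meetsAll s

insets : ℕ → Vec ℕ n → ℕ → ℕ
insets m q t = sumᴸ (map (indicator (isInsetOfSize t)) (subsets (groundLabels q m)))

insetCount≡insets : (m k : ℕ) (q : Vec ℕ n) → insetCount m k q ≡ insets m q (n + k)
insetCount≡insets m k q = length-filter-true _ (subsets (groundLabels q m))

liftLabel : Maybe (Fin n) → Maybe (Fin (suc n))
liftLabel = Maybe.map Fin.suc

groundLabels-∷ : (q₀ : ℕ) (q : Vec ℕ n) (m : ℕ) →
  groundLabels (q₀ ∷ q) m ≡ replicate q₀ (just Fin.zero) ++ map liftLabel (groundLabels q m)
groundLabels-∷ {n} q₀ q m = begin
    (replicate q₀ (just Fin.zero) ++ concat (map block′ (tabulate Fin.suc))) ++ replicate m nothing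
  ≡⟨ ++-assoc (replicate q₀ (just Fin.zero)) _ _ ⟩
    replicate q₀ (just Fin.zero) ++ (concat (map block′ (tabulate Fin.suc)) ++ replicate m nothing)
  ≡⟨ cong (replicate q₀ (just Fin.zero) ++_) (cong₂ _++_ blocks (sym (map-replicate liftLabel m nothing))) ⟩
    replicate q₀ (just Fin.zero) ++ (map liftLabel (concat (map block (allFin n))) ++ map liftLabel (replicate m nothing))
  ≡⟨ cong (replicate q₀ (just Fin.zero) ++_) (map-++ liftLabel _ (replicate m nothing)) ⟨
    replicate q₀ (just Fin.zero) ++ map liftLabel (groundLabels q m)
  ∎
  where
  open ≡-Reasoning
  block : Fin n → List (Maybe (Fin n))
  block i = replicate (lookup q i) (just i)
  block′ : Fin (suc n) → List (Maybe (Fin (suc n)))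
  block′ i = replicate (lookup (q₀ ∷ q) i) (just i)
  blocks : concat (map block′ (tabulate Fin.suc)) ≡ map liftLabel (concat (map block (allFin n)))
  blocks = begin
      concat (map block′ (tabulate Fin.suc))
    ≡⟨ cong concat (map-tabulate Fin.suc block′) ⟩
      concat (tabulate (block′ ∘ Fin.suc))
    ≡⟨ cong concat (tabulate-cong (λ i → sym (map-replicate liftLabel _ (just i)))) ⟩
      concat (tabulate (map liftLabel ∘ block))
    ≡⟨ cong concat (trans (sym (map-tabulate (λ i → i) (map liftLabel ∘ block))) (map-∘ (allFin n))) ⟩
      concat (map (map liftLabel) (map block (allFin n)))
    ≡⟨ concat-map (map block (allFin n)) ⟩
      map liftLabel (concat (map block (allFin n)))
    ∎

meets-zero-lift : (b : List (Maybe (Fin n))) → meets Fin.zero (map liftLabel b) ≡ false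
meets-zero-lift [] = refl
meets-zero-lift (just j ∷ b) = meets-zero-lift b
meets-zero-lift (nothing ∷ b) = meets-zero-lift b

suc≟ᶠsuc : (i j : Fin n) → ⌊ Fin.suc i ≟ᶠ Fin.suc j ⌋ ≡ ⌊ i ≟ᶠ j ⌋
suc≟ᶠsuc i j with i ≟ᶠ j
... | yes _ = refl
... | no _ = refl

meets-suc-lift : (i : Fin n) (b : List (Maybe (Fin n))) → meets (Fin.suc i) (map liftLabel b) ≡ meets i b
meets-suc-lift i [] = refl
meets-suc-lift i (just j ∷ b) = cong₂ _∨_ (suc≟ᶠsuc i j) (meets-suc-lift i b)
meets-suc-lift i (nothing ∷ b) = meets-suc-lift i b

meets-suc-replicate-zero : ∀ l (i : Fin n) (s : List (Maybe (Fin (suc n)))) →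
  meets (Fin.suc i) (replicate l (just Fin.zero) ++ s) ≡ meets (Fin.suc i) s
meets-suc-replicate-zero zero i s = refl
meets-suc-replicate-zero (suc l) i s = meets-suc-replicate-zero l i s

meetsAll-∷ : ∀ l (b : List (Maybe (Fin n))) → let s = replicate l (just Fin.zero) ++ map liftLabel b in
  meetsAll s ≡ meets Fin.zero s ∧ meetsAll b
meetsAll-∷ {n} l b = cong (meets Fin.zero s ∧_) (cong (foldr _∧_ true) (begin
    map (λ i → meets i s) (tabulate Fin.suc)
  ≡⟨ map-tabulate Fin.suc (λ i → meets i s) ⟩
    tabulate (λ i → meets (Fin.suc i) s)
  ≡⟨ tabulate-cong (λ i → trans (meets-suc-replicate-zero l i (map liftLabel b)) (meets-suc-lift i b)) ⟩
    tabulate (λ i → meets i b)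
  ≡⟨ map-tabulate (λ i → i) (λ i → meets i b) ⟨
    map (λ i → meets i b) (allFin n)
  ∎))
  where
  open ≡-Reasoning
  s = replicate l (just Fin.zero) ++ map liftLabel b

isInsetOfSize-∷ : ∀ t l (b : List (Maybe (Fin n))) → let s = replicate l (just Fin.zero) ++ map liftLabel b in
  isInsetOfSize t s ≡ (l + length b ≡ᵇ t) ∧ (meets Fin.zero s ∧ meetsAll b)
isInsetOfSize-∷ t l b = cong₂ _∧_ (cong (_≡ᵇ t) length-s) (meetsAll-∷ l b)
  where
  length-s : length (replicate l (just Fin.zero) ++ map liftLabel b) ≡ l + length b
  length-s = trans (length-++ (replicate l _)) (cong₂ _+_ (length-replicate l) (length-map liftLabel b))

module FirstBlock {n} (m q₀ : ℕ) (q : Vec ℕ n) where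

  -- Every l-subset of X₁ has the same list of labels, so its extensions depend on l only.
  restCount : ℕ → ℕ → ℕ
  restCount t l = sumᴸ (map (indicator (λ b → isInsetOfSize t (replicate l (just Fin.zero) ++ map liftLabel b)))
                            (subsets (groundLabels q m)))

  insets-∷ : ∀ t → insets m (q₀ ∷ q) t ≡ binomialSum q₀ (restCount t)
  insets-∷ t = begin
      sumᴸ (map F (subsets (groundLabels (q₀ ∷ q) m)))
    ≡⟨ cong (λ X → sumᴸ (map F (subsets X))) (groundLabels-∷ q₀ q m) ⟩
      sumᴸ (map F (subsets (replicate q₀ (just Fin.zero) ++ map liftLabel G)))
    ≡⟨ cong (sumᴸ ∘ map F) (subsets-++ (replicate q₀ (just Fin.zero)) (map liftLabel G)) ⟩
      sumᴸ (map F (concatMap (λ a → map (a ++_) R) S₁))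
    ≡⟨ cong sumᴸ (map-concatMap F _ S₁) ⟩
      sumᴸ (concatMap (λ a → map F (map (a ++_) R)) S₁)
    ≡⟨ sumᴸ-concatMap _ S₁ ⟩
      sumᴸ (map (λ a → sumᴸ (map F (map (a ++_) R))) S₁)
    ≡⟨ sumᴸ-subsets-replicate _ q₀ (just Fin.zero) ⟩
      binomialSum q₀ (λ l → sumᴸ (map F (map (replicate l (just Fin.zero) ++_) R)))
    ≡⟨ binomialSum-cong q₀ (λ l → cong sumᴸ (trans (sym (map-∘ R))
         (trans (cong (map _) (subsets-map liftLabel G)) (sym (map-∘ (subsets G)))))) ⟩
      binomialSum q₀ (restCount t)
    ∎
    where
    open ≡-Reasoning
    F = indicator (isInsetOfSize t)
    G = groundLabels q m
    S₁ = subsets (replicate q₀ (just Fin.zero))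
    R = subsets (map liftLabel G)

  restCount-zero : ∀ t → restCount t 0 ≡ 0
  restCount-zero t = sumᴸ-map-zero _ (λ b → cong (λ x → if x then 1 else 0) (begin
      isInsetOfSize t (map liftLabel b)
    ≡⟨ isInsetOfSize-∷ t 0 b ⟩
      (length b ≡ᵇ t) ∧ (meets Fin.zero (map liftLabel b) ∧ meetsAll b)
    ≡⟨ cong (λ x → (length b ≡ᵇ t) ∧ (x ∧ meetsAll b)) (meets-zero-lift b) ⟩
      (length b ≡ᵇ t) ∧ false
    ≡⟨ ∧-zeroʳ _ ⟩
      false
    ∎)) (subsets (groundLabels q m))
    where open ≡-Reasoning

  restCount-short : ∀ t l → t < suc l → restCount t (suc l) ≡ 0
  restCount-short t l t<l = sumᴸ-map-zero _ (λ b → cong (λ x → if x then 1 else 0)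
    (trans (isInsetOfSize-∷ t (suc l) b) (cong (_∧ meetsAll b) (m+n≡ᵇo≡false (suc l) (length b) t t<l))))
    (subsets (groundLabels q m))

  restCount-shift : ∀ l d → restCount (suc l + d) (suc l) ≡ insets m q d
  restCount-shift l d = cong sumᴸ (map-cong (λ b → cong (λ x → if x then 1 else 0)
    (trans (isInsetOfSize-∷ (suc l + d) (suc l) b) (cong (_∧ meetsAll b) (l+m≡ᵇl+n (suc l) (length b) d))))
    (subsets (groundLabels q m)))

  restCount-vanishes : (∀ {d} → d < n → insets m q d ≡ 0) →
    ∀ {t} l → t < suc l + n → restCount t (suc l) ≡ 0
  restCount-vanishes below {t} l t<l+n with t <? suc l
  ... | yes t<l = restCount-short t l t<l
  ... | no t≮l with m≤n⇒∃[o]m+o≡n (≮⇒≥ t≮l)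
  ... | d , refl = trans (restCount-shift l d) (below (+-cancelˡ-< (suc l) d n t<l+n))

insets-below : ∀ m (q : Vec ℕ n) {t} → t < n → insets m q t ≡ 0
insets-below m [] ()
insets-below m (q₀ ∷ q) {t} (s≤s t≤n) = trans (insets-∷ t) (binomialSum-zero q₀ vanish)
  where
  open FirstBlock m q₀ q
  vanish : ∀ l → restCount t l ≡ 0
  vanish zero = restCount-zero t
  vanish (suc l) = restCount-vanishes (insets-below m q) l (s≤s (≤-trans t≤n (m≤n+m _ l)))

insets-[] : ∀ m t → insets m [] t ≡ binomialSum m (indicator (_≡ᵇ t))
insets-[] m t = trans (sumᴸ-subsets-replicate _ m nothing) (binomialSum-cong m (λ l →
  cong (λ x → if x then 1 else 0) (trans (∧-identityʳ _) (cong (_≡ᵇ t) (length-replicate l)))))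

insets-minimal : ∀ m (q : Vec ℕ n) → insets m q n ≡ prodV q
insets-minimal m [] = begin
    insets m [] 0
  ≡⟨ trans (insets-[] m 0) (binomialSum-quadratic m _ refl refl refl (λ _ → refl)) ⟩
    1 + m * 0 + choose₂ m * 0
  ≡⟨ cong₂ (λ x y → 1 + x + y) (*-zeroʳ m) (*-zeroʳ (choose₂ m)) ⟩
    1
  ∎
  where open ≡-Reasoning
insets-minimal {suc n} m (q₀ ∷ q) = begin
    insets m (q₀ ∷ q) (suc n)
  ≡⟨ insets-∷ (suc n) ⟩
    binomialSum q₀ (restCount (suc n))
  ≡⟨ binomialSum-quadratic q₀ _ (restCount-zero _) (trans (restCount-shift 0 n) (insets-minimal m q))
                                (vanish 0) (vanish ∘ suc) ⟩
    0 + q₀ * prodV q + choose₂ q₀ * 0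
  ≡⟨ trans (cong (q₀ * prodV q +_) (*-zeroʳ (choose₂ q₀))) (+-identityʳ _) ⟩
    q₀ * prodV q
  ∎
  where
  open ≡-Reasoning
  open FirstBlock m q₀ q
  vanish : ∀ l → restCount (suc n) (2 + l) ≡ 0
  vanish l = restCount-vanishes (insets-below m q) (suc l) (s≤s (s≤s (m≤n+m n l)))

insets-minimal+1 : ∀ m (q : Vec ℕ n) → 2 * insets m q (suc n) + n * prodV q ≡ prodV q * (sum q + 2 * m)
insets-minimal+1 m [] = begin
    2 * insets m [] 1 + 0
  ≡⟨ cong (λ x → 2 * x + 0) (trans (insets-[] m 1) (binomialSum-quadratic m _ refl refl refl (λ _ → refl))) ⟩
    2 * (0 + m * 1 + choose₂ m * 0) + 0
  ≡⟨ simplify m (choose₂ m) ⟩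
    1 * (0 + 2 * m)
  ∎
  where
  open ≡-Reasoning
  simplify : ∀ m k → 2 * (0 + m * 1 + k * 0) + 0 ≡ 1 * (0 + 2 * m)
  simplify = solve-∀
insets-minimal+1 {suc n} m (q₀ ∷ q) = begin
    2 * insets m (q₀ ∷ q) (2 + n) + suc n * (q₀ * P)
  ≡⟨ cong (λ x → 2 * x + suc n * (q₀ * P)) (trans (insets-∷ (2 + n))
       (binomialSum-quadratic q₀ _ (restCount-zero _) (restCount-shift 0 (suc n))
                                   (trans (restCount-shift 1 n) (insets-minimal m q)) vanish)) ⟩
    2 * (0 + q₀ * J + choose₂ q₀ * P) + suc n * (q₀ * P)
  ≡⟨ regroup q₀ J P n (choose₂ q₀) ⟩
    q₀ * (2 * J + n * P) + (2 * choose₂ q₀ + q₀) * P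
  ≡⟨ cong₂ (λ x y → q₀ * x + y * P) (insets-minimal+1 m q) (2*choose₂+q≡q*q q₀) ⟩
    q₀ * (P * (sum q + 2 * m)) + q₀ * q₀ * P
  ≡⟨ collect q₀ P (sum q) m ⟩
    q₀ * P * (q₀ + sum q + 2 * m)
  ∎
  where
  open ≡-Reasoning
  open FirstBlock m q₀ q
  P = prodV q
  J = insets m q (suc n)
  vanish : ∀ l → restCount (2 + n) (3 + l) ≡ 0
  vanish l = restCount-vanishes (insets-below m q) (2 + l) (s≤s (s≤s (s≤s (m≤n+m n l))))
  regroup : ∀ q₀ J P n k → 2 * (0 + q₀ * J + k * P) + suc n * (q₀ * P) ≡ q₀ * (2 * J + n * P) + (2 * k + q₀) * P
  regroup = solve-∀
  collect : ∀ q₀ P S m → q₀ * (P * (S + 2 * m)) + q₀ * q₀ * P ≡ q₀ * P * (q₀ + S + 2 * m)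
  collect = solve-∀

length≤sum : (q : Vec ℕ n) → All (λ qi → qi ≥ 1) q → n ≤ sum q
length≤sum [] [] = z≤n
length≤sum (q₀ ∷ q) (q₀≥1 ∷ q≥1) = +-mono-≤ q₀≥1 (length≤sum q q≥1)

mainTheorem4 : (n : ℕ) → n ≥ 1 → (q : Vec ℕ n) → All (λ qi → qi ≥ 1) q →
    2 * insetCount 1 1 q ≡ prodV q * (sum q ∸ n + 2)
mainTheorem4 n _ q q≥1 = +-cancelʳ-≡ (n * prodV q) _ _ (begin
    2 * insetCount 1 1 q + n * prodV q
  ≡⟨ cong (λ c → 2 * c + n * prodV q) (trans (insetCount≡insets 1 1 q) (cong (insets 1 q) (+-comm n 1))) ⟩
    2 * insets 1 q (suc n) + n * prodV q
  ≡⟨ insets-minimal+1 1 q ⟩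
    prodV q * (sum q + 2)
  ≡⟨ cong (λ s → prodV q * (s + 2)) (m∸n+n≡m (length≤sum q q≥1)) ⟨
    prodV q * (sum q ∸ n + n + 2)
  ≡⟨ split (prodV q) (sum q ∸ n) n ⟩
    prodV q * (sum q ∸ n + 2) + n * prodV q
  ∎)
  where
  open ≡-Reasoning
  split : ∀ P d n → P * (d + n + 2) ≡ P * (d + 2) + n * P
  split = solve-∀
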